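{- Let $\Delta$ be a pure simplicial complex on vertex set $V$, and suppose $V=V_1\cup\dots\cup V_k$ is a disjoint union of pure factors $V_1,\dots,V_k$ of $\Delta$. Then $\Delta|_{V_i}$ is pure for each $1\le i\le k$, and $\Delta$ is a top-dimensional subcomplex of the join $\{F_1\cup\dots\cup F_k: F_i\text{ a face of }\Delta|_{V_i}\text{ for each }i\}$, i.e. $\Delta$ is a subcomplex of this join and every facet of $\Delta$ is a facet of the join.
   Context: A subset $W\subseteq V$ is a pure factor of the pure complex $\Delta$ if the number $|f\cap W|$ is the same for all facets $f$ of $\Delta$. For $W\subseteq V$, $\Delta|_W=\{F\in\Delta: F\subseteq W\}$ is the full subcomplex supported on $W$. -}

module Defs where

open import Data.Nat using (ℕ)
open import Data.Fin using (Fin)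
open import Data.Fin.Subset using (Subset; _∈_; _⊆_; _∩_; ⋃; ∣_∣; ⊥)
open import Data.List using (tabulate)
open import Data.Product using (Σ; ∃; _×_)
open import Relation.Binary.PropositionalEquality using (_≡_; _≢_)
open import Relation.Unary using (Pred; Decidable)
open import Level using (0ℓ)

SetSystem : ℕ → Set₁
SetSystem n = Pred (Subset n) 0ℓ

record SimplicialComplex (n : ℕ) : Set₁ where
  field
    face     : SetSystem n
    face?    : Decidable face
    hasEmpty : face ⊥
    downward : ∀ {F G} → G ⊆ F → face F → face G
open SimplicialComplex public

IsFacet : ∀ {n} → SetSystem n → Subset n → Set
IsFacet Δ F = Δ F × (∀ G → Δ G → F ⊆ G → G ≡ F)

Pure : ∀ {n} → SetSystem n → Set
Pure Δ = ∀ F G → IsFacet Δ F → IsFacet Δ G → ∣ F ∣ ≡ ∣ G ∣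

PureFactor : ∀ {n} → SetSystem n → Subset n → Set
PureFactor Δ W = ∀ F G → IsFacet Δ F → IsFacet Δ G → ∣ F ∩ W ∣ ≡ ∣ G ∩ W ∣

restrict : ∀ {n} → SetSystem n → Subset n → SetSystem n
restrict Δ W F = Δ F × F ⊆ W

join : ∀ {n k} → SetSystem n → (Fin k → Subset n) → SetSystem n
join Δ V F = Σ (Fin _ → Subset _) λ Fs →
  (∀ i → restrict Δ (V i) (Fs i)) × F ≡ ⋃ (tabulate Fs)

IsPartition : ∀ {n k} → (Fin k → Subset n) → Set
IsPartition V = (∀ i j → i ≢ j → V i ∩ V j ≡ ⊥) × (∀ x → ∃ λ i → x ∈ V i)

{-# OPTIONS --safe #-}
module Submission where

-- Every face of Δ|_{V_j} lies in a facet of Δ|_{V_j}, which is the trace f ∩ V_j of a facet f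
-- of Δ; as V_j is a pure factor, faces of Δ|_{V_j} therefore have at most |F ∩ V_j| vertices
-- for every facet F of Δ.  Every face F of Δ is the join of
-- its traces F ∩ V_j; if F is a facet and F ⊆ G₁ ∪ … ∪ G_k with G_j a face of Δ|_{V_j}, then
-- disjointness of the V_j forces F ∩ V_j ⊆ G_j, and the cardinality bound forces equality.

open import Defs
open import Data.Nat using (ℕ; _≤_; _<_; _∸_)
open import Data.Nat.Properties using (<⇒≱; ≤-trans; ≤-reflexive; ∸-monoʳ-<)
open import Data.Nat.Induction using (<-wellFounded)
open import Data.Fin using (Fin; _≟_)
open import Data.Fin.Subset using (Subset; _∈_; _⊆_; _⊃_; _⊄_; _∩_; ⋃; ∣_∣; ⊥)
open import Data.Fin.Subset.Properties
  using (anySubset?; _∈?_; _⊆?_; _⊂?_; ⊆-refl; ⊆-trans; ⊆-antisym; ∉⊥; ∣p∣≤n;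
         p⊆q⇒∣p∣≤∣q∣; p⊂q⇒∣p∣<∣q∣; p∩q⊆p; p∩q⊆q; x∈p∩q⁺; x∈p∩q⁻; x∈p∪q⁺; x∈p∪q⁻)
open import Data.List using (List; []; _∷_; tabulate)
open import Data.List.Properties using (tabulate-cong)
open import Data.List.Relation.Unary.Any using (Any; here; there)
open import Data.List.Relation.Unary.Any.Properties using (tabulate⁺; tabulate⁻)
open import Data.Product using (∃; _×_; _,_; proj₁; proj₂)
open import Data.Sum using (inj₁; inj₂)
open import Function using (_on_)
open import Induction.WellFounded using (WellFounded; Acc; acc; module Subrelation)
open import Relation.Binary.Construct.On as On using ()
open import Relation.Nullary using (yes; no; contradiction)
open import Relation.Nullary.Decidable using (_×-dec_)
open import Relation.Unary using (Decidable)
open import Relation.Binary.PropositionalEquality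
  using (_≡_; _≢_; sym; trans; cong; subst; module ≡-Reasoning)

private
  variable
    n k : ℕ

p⊆q∧p⊄q⇒q≡p : {p q : Subset n} → p ⊆ q → p ⊄ q → q ≡ p
p⊆q∧p⊄q⇒q≡p {p = p} {q} p⊆q p⊄q = ⊆-antisym q⊆p p⊆q
  where
  q⊆p : q ⊆ p
  q⊆p {x} x∈q with x ∈? p
  ... | yes x∈p = x∈p
  ... | no  x∉p = contradiction ((λ {y} → p⊆q {y}) , x , x∈q , x∉p) p⊄q

p⊆q∧∣q∣≤∣p∣⇒q≡p : {p q : Subset n} → p ⊆ q → ∣ q ∣ ≤ ∣ p ∣ → q ≡ p
p⊆q∧∣q∣≤∣p∣⇒q≡p p⊆q ∣q∣≤∣p∣ = p⊆q∧p⊄q⇒q≡p p⊆q (λ p⊂q → <⇒≱ (p⊂q⇒∣p∣<∣q∣ p⊂q) ∣q∣≤∣p∣)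

⊃-wellFounded : WellFounded (_⊃_ {n})
⊃-wellFounded {n} = Subrelation.wellFounded ⊃⇒∸∣∣< (On.wellFounded (λ p → n ∸ ∣ p ∣) <-wellFounded)
  where
  ⊃⇒∸∣∣< : {p q : Subset n} → p ⊃ q → (_<_ on (λ r → n ∸ ∣ r ∣)) p q
  ⊃⇒∸∣∣< {p} q⊂p = ∸-monoʳ-< (p⊂q⇒∣p∣<∣q∣ q⊂p) (∣p∣≤n p)

x∈⋃⁺ : {x : Fin n} (ps : List (Subset n)) → Any (x ∈_) ps → x ∈ ⋃ ps
x∈⋃⁺ (p ∷ ps) (here x∈p)   = x∈p∪q⁺ (inj₁ x∈p)
x∈⋃⁺ (p ∷ ps) (there x∈ps) = x∈p∪q⁺ {p = p} (inj₂ (x∈⋃⁺ ps x∈ps))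

x∈⋃⁻ : {x : Fin n} (ps : List (Subset n)) → x ∈ ⋃ ps → Any (x ∈_) ps
x∈⋃⁻ []       x∈⊥ = contradiction x∈⊥ ∉⊥
x∈⋃⁻ (p ∷ ps) x∈⋃ with x∈p∪q⁻ p (⋃ ps) x∈⋃
... | inj₁ x∈p  = here x∈p
... | inj₂ x∈ps = there (x∈⋃⁻ ps x∈ps)

module _ (P : SetSystem n) (P? : Decidable P) where

  ⊆-facet-acc : {F : Subset n} → Acc _⊃_ F → P F → ∃ λ G → F ⊆ G × IsFacet P G
  ⊆-facet-acc {F} (acc rs) PF with anySubset? (λ G → P? G ×-dec F ⊂? G)
  ... | yes (G , PG , F⊂G) =
    let H , G⊆H , facetH = ⊆-facet-acc (rs F⊂G) PG
    in  H , ⊆-trans (proj₁ F⊂G) G⊆H , facetH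
  ... | no ∄G =
    F , ⊆-refl , PF , λ G PG F⊆G → p⊆q∧p⊄q⇒q≡p F⊆G (λ F⊂G → ∄G (G , PG , F⊂G))

  ⊆-facet : {F : Subset n} → P F → ∃ λ G → F ⊆ G × IsFacet P G
  ⊆-facet {F} = ⊆-facet-acc (⊃-wellFounded F)

module _ (Δ : SimplicialComplex n) {W : Subset n} where

  restrict? : Decidable (restrict (face Δ) W)
  restrict? F = face? Δ F ×-dec F ⊆? W

  ∩-restrict : ∀ {F} → face Δ F → restrict (face Δ) W (F ∩ W)
  ∩-restrict {F} ΔF = downward Δ (p∩q⊆p F W) ΔF , p∩q⊆q F W

  facet-restrict⇒∩ : ∀ {A} → IsFacet (restrict (face Δ) W) A →
                     ∃ λ F → IsFacet (face Δ) F × F ∩ W ≡ A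
  facet-restrict⇒∩ ((ΔA , A⊆W) , maximal) =
    let F , A⊆F , facetF = ⊆-facet (face Δ) (face? Δ) ΔA
    in  F , facetF , maximal (F ∩ W) (∩-restrict (proj₁ facetF)) (λ x∈A → x∈p∩q⁺ (A⊆F x∈A , A⊆W x∈A))

  module _ (W-pure : PureFactor (face Δ) W) where

    ∣facet-restrict∣≡∣facet∩∣ : ∀ {A F} → IsFacet (restrict (face Δ) W) A → IsFacet (face Δ) F →
                               ∣ A ∣ ≡ ∣ F ∩ W ∣
    ∣facet-restrict∣≡∣facet∩∣ {F = F} facetA facetF =
      let G , facetG , G∩W≡A = facet-restrict⇒∩ facetA
      in  subst (λ B → ∣ B ∣ ≡ ∣ F ∩ W ∣) G∩W≡A (W-pure G F facetG facetF)

    ∣face-restrict∣≤∣facet∩∣ : ∀ {A F} → restrict (face Δ) W A → IsFacet (face Δ) F →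
                              ∣ A ∣ ≤ ∣ F ∩ W ∣
    ∣face-restrict∣≤∣facet∩∣ ΔA facetF =
      let B , A⊆B , facetB = ⊆-facet (restrict (face Δ) W) restrict? ΔA
      in  ≤-trans (p⊆q⇒∣p∣≤∣q∣ A⊆B) (≤-reflexive (∣facet-restrict∣≡∣facet∩∣ facetB facetF))

    pureFactor⇒pure-restrict : Pure (restrict (face Δ) W)
    pureFactor⇒pure-restrict A B facetA facetB =
      let F , facetF , _ = facet-restrict⇒∩ facetA
      in  trans (∣facet-restrict∣≡∣facet∩∣ facetA facetF) (sym (∣facet-restrict∣≡∣facet∩∣ facetB facetF))

module _ {V : Fin k → Subset n} where

  ≡⋃∩ : (∀ x → ∃ λ i → x ∈ V i) → (F : Subset n) → F ≡ ⋃ (tabulate (λ i → F ∩ V i))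
  ≡⋃∩ cover F = ⊆-antisym F⊆⋃ ⋃⊆F
    where
    F⊆⋃ : F ⊆ ⋃ (tabulate (λ i → F ∩ V i))
    F⊆⋃ {x} x∈F = let i , x∈Vi = cover x in x∈⋃⁺ _ (tabulate⁺ i (x∈p∩q⁺ (x∈F , x∈Vi)))

    ⋃⊆F : ⋃ (tabulate (λ i → F ∩ V i)) ⊆ F
    ⋃⊆F x∈⋃ = let i , x∈F∩Vi = tabulate⁻ (x∈⋃⁻ _ x∈⋃) in proj₁ (x∈p∩q⁻ F (V i) x∈F∩Vi)

  ∈-disjoint⇒≡ : (∀ i j → i ≢ j → V i ∩ V j ≡ ⊥) → ∀ {x i j} → x ∈ V i → x ∈ V j → i ≡ j
  ∈-disjoint⇒≡ disjoint {x} {i} {j} x∈Vi x∈Vj with i ≟ j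
  ... | yes i≡j = i≡j
  ... | no  i≢j = contradiction (subst (x ∈_) (disjoint i j i≢j) (x∈p∩q⁺ (x∈Vi , x∈Vj))) ∉⊥

  module _ (Δ : SimplicialComplex n) where

    face⇒join : (∀ x → ∃ λ i → x ∈ V i) → ∀ {F} → face Δ F → join (face Δ) V F
    face⇒join cover {F} ΔF = (λ i → F ∩ V i) , (λ i → ∩-restrict Δ ΔF) , ≡⋃∩ cover F

    facet⇒join-facet : IsPartition V → (∀ i → PureFactor (face Δ) (V i)) →
                       ∀ {F} → IsFacet (face Δ) F → IsFacet (join (face Δ) V) F
    facet⇒join-facet (disjoint , cover) pureFactors {F} facetF =
      face⇒join cover (proj₁ facetF) , maximal
      where
      maximal : ∀ G → join (face Δ) V G → F ⊆ G → G ≡ F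
      maximal G (Gs , ΔGs , G≡⋃Gs) F⊆G = begin
        G                             ≡⟨ G≡⋃Gs ⟩
        ⋃ (tabulate Gs)               ≡⟨ cong ⋃ (tabulate-cong Gs≡F∩V) ⟩
        ⋃ (tabulate (λ i → F ∩ V i))  ≡⟨ sym (≡⋃∩ cover F) ⟩
        F                             ∎
        where
        open ≡-Reasoning

        F∩V⊆Gs : ∀ j → F ∩ V j ⊆ Gs j
        F∩V⊆Gs j {x} x∈F∩Vj =
          let x∈F , x∈Vj = x∈p∩q⁻ F (V j) x∈F∩Vj
              i , x∈Gsi  = tabulate⁻ (x∈⋃⁻ (tabulate Gs) (subst (x ∈_) G≡⋃Gs (F⊆G x∈F)))
          in  subst (λ i → x ∈ Gs i) (∈-disjoint⇒≡ disjoint (proj₂ (ΔGs i) x∈Gsi) x∈Vj) x∈Gsi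

        Gs≡F∩V : ∀ j → Gs j ≡ F ∩ V j
        Gs≡F∩V j = p⊆q∧∣q∣≤∣p∣⇒q≡p (F∩V⊆Gs j) (∣face-restrict∣≤∣facet∩∣ Δ (pureFactors j) (ΔGs j) facetF)

proposition3p1 : ∀ {n k} (Δ : SimplicialComplex n) (V : Fin k → Subset n) →
    Pure (face Δ) → IsPartition V → (∀ i → PureFactor (face Δ) (V i)) →
    (∀ i → Pure (restrict (face Δ) (V i)))
    × (∀ F → face Δ F → join (face Δ) V F)
    × (∀ F → IsFacet (face Δ) F → IsFacet (join (face Δ) V) F)
proposition3p1 Δ V _ partition@(_ , cover) pureFactors =
    (λ i → pureFactor⇒pure-restrict Δ (pureFactors i))
  , (λ F → face⇒join Δ cover)
  , (λ F → facet⇒join-facet Δ partition pureFactors)
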